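{- Let $k$, $a$, $b$, and $\ell$ be positive integers with $k = a\ell$ and $a \le b$. Let $P = \{0, b, 2b, \ldots, (\ell-1)b\}$ and let \[ A = P + [0,a-1] = \bigcup_{j=1}^{\ell} \left( (j-1)b + [0,a-1] \right). \] Then $|A| = k$. Moreover, for every positive integer $h$, letting $Q = \{0, b, 2b, \ldots, h(\ell-1)b\}$, we have \[ hA = Q + [0, h(a-1)] \] and \[ |hA| = \begin{cases} (a + b(\ell-1) - 1)h + 1 & \text{if } a \le b \le (a-1)h+1, \\ (a-1)(\ell-1)h^2 + (a+\ell-2)h + 1 & \text{if } b \ge h(a-1)+1. \end{cases} \]
   Context: For real numbers $u\le v$, $[u,v]$ denotes the integer interval $\{n\in\mathbf{Z}: u\le n\le v\}$. For sets $X,Y$ of integers, $X+Y=\{x+y : x\in X, y\in Y\}$ and $t + X = \{t+x : x \in X\}$. For a nonempty set $A$ of integers and a positive integer $h$, the $h$-fold sumset $hA$ is the set of all sums $a_1+\cdots+a_h$ of $h$ not necessarily distinct elements $a_1,\ldots,a_h\in A$. -}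

module Defs where

open import Level using (0ℓ)
open import Data.Nat as ℕ using (ℕ; suc)
open import Data.Integer using (ℤ; +_; _+_; _*_; _≤_)
open import Data.Product using (Σ; ∃; ∃-syntax; _×_)
open import Data.List using (List; length)
open import Data.List.Relation.Unary.Unique.Propositional using (Unique)
open import Data.List.Membership.Propositional using (_∈_)
open import Data.Vec using (Vec)
open import Data.Vec.Relation.Unary.All using (All)
open import Relation.Binary.PropositionalEquality using (_≡_)
open import Function.Bundles using (_⇔_)

ZSet : Set₁
ZSet = ℤ → Set

Icc : ℤ → ℤ → ZSet
Icc u v n = (u ≤ n) × (n ≤ v)

_⊕_ : ZSet → ZSet → ZSet
(X ⊕ Y) n = ∃[ x ] ∃[ y ] (X x × Y y × n ≡ x + y)

vsum : ∀ {h} → Vec ℤ h → ℤ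
vsum Vec.[] = + 0
vsum (x Vec.∷ xs) = x + vsum xs

hfold : ℕ → ZSet → ZSet
hfold h A n = Σ (Vec ℤ h) λ v → All A v × vsum v ≡ n

_≐_ : ZSet → ZSet → Set
X ≐ Y = ∀ n → X n ⇔ Y n

HasCard : ZSet → ℕ → Set
HasCard X k = Σ (List ℤ) λ xs → Unique xs × (∀ n → X n ⇔ (n ∈ xs)) × length xs ≡ k

AP : ℕ → ℕ → ZSet
AP d m n = ∃[ j ] (j ℕ.≤ m × n ≡ + (j ℕ.* d))

-- Write A = P + [0, a-1] as the union of the ℓ blocks jb + [0, a-1].  Sums of
-- such blocks add their indices j and their offsets i independently, so hA is
-- the union of the h(ℓ-1)+1 blocks jb + [0, h(a-1)].  When b ≤ h(a-1)+1 each
-- block reaches the next one and hA is a single interval; when b > h(a-1) the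
-- blocks are disjoint and, by uniqueness of Euclidean division by b, they have
-- (h(ℓ-1)+1)(h(a-1)+1) elements in total.  The case h = 1 gives |A| = aℓ.
module Submission where

open import Defs
open import Data.Nat using (ℕ; _+_; _*_; _∸_; _^_; _≤_)
open import Data.Integer using (+_)
open import Data.Product using (_×_)
open import Relation.Binary.PropositionalEquality using (_≡_)

open import Data.Nat using (suc; zero; z≤n; s≤s; _<_; _⊓_; _≤?_)
open import Data.Nat.Properties
open import Data.Nat.DivMod using (_%_; [m+kn]%n≡m%n; m<n⇒m%n≡m)
open import Data.Nat.Tactic.RingSolver using (solve-∀)
open import Data.Integer using (+≤+)
open import Data.Integer.Properties using (+-injective)
open import Data.Fin using (Fin; toℕ)
open import Data.Fin.Properties using (toℕ-fromℕ<; toℕ≤pred[n]; toℕ-injective)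
open import Data.Product using (Σ; ∃-syntax; _,_)
open import Data.List using (List; []; _∷_; _++_; map; upTo; allFin; length; cartesianProductWith)
open import Data.List.Properties using (length-++; length-map; length-upTo; length-tabulate)
open import Data.List.Membership.Propositional using (_∈_)
open import Data.List.Membership.Propositional.Properties
  using (∈-map⁺; ∈-map⁻; ∈-upTo⁺; ∈-upTo⁻; ∈-allFin; ∈-cartesianProductWith⁺; ∈-cartesianProductWith⁻)
open import Data.List.Relation.Unary.Unique.Propositional using (Unique)
import Data.List.Relation.Unary.Unique.Propositional.Properties as Unique
open import Data.Vec using ([]; _∷_)
open import Data.Vec.Relation.Unary.All using ([]; _∷_)
open import Relation.Binary.PropositionalEquality using (refl; sym; trans; cong; cong₂; subst; module ≡-Reasoning)
open import Relation.Nullary using (yes; no)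
open import Function.Bundles using (_⇔_; mk⇔; Equivalence)
import Function.Properties.Equivalence as ⇔

open Equivalence

≐-sym : {X Y : ZSet} → X ≐ Y → Y ≐ X
≐-sym X≐Y n = ⇔.sym (X≐Y n)

≐-trans : {X Y Z : ZSet} → X ≐ Y → Y ≐ Z → X ≐ Z
≐-trans X≐Y Y≐Z n = ⇔.trans (X≐Y n) (Y≐Z n)

⊕-congˡ : {X Y Y′ : ZSet} → Y ≐ Y′ → (X ⊕ Y) ≐ (X ⊕ Y′)
⊕-congˡ Y≐Y′ n = mk⇔
  (λ (x , y , x∈X , y∈Y , eq) → x , y , x∈X , to (Y≐Y′ y) y∈Y , eq)
  (λ (x , y , x∈X , y∈Y′ , eq) → x , y , x∈X , from (Y≐Y′ y) y∈Y′ , eq)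

hfold-zero : (A : ZSet) → hfold 0 A ≐ (_≡ + 0)
hfold-zero A n = mk⇔ (λ { ([] , [] , refl) → refl }) (λ { refl → [] , [] , refl })

hfold-suc : (h : ℕ) (A : ZSet) → hfold (suc h) A ≐ (A ⊕ hfold h A)
hfold-suc h A n = mk⇔
  (λ { (x ∷ v , x∈A ∷ v∈A , refl) → x , vsum v , x∈A , (v , v∈A , refl) , refl })
  (λ { (x , _ , x∈A , (v , v∈A , refl) , refl) → x ∷ v , x∈A ∷ v∈A , refl })

HasCard-resp-≐ : {X Y : ZSet} {k : ℕ} → X ≐ Y → HasCard Y k → HasCard X k
HasCard-resp-≐ X≐Y (xs , unique , Y⇔xs , len) =
  xs , unique , (λ n → ⇔.trans (X≐Y n) (Y⇔xs n)) , len

HasCardℕ : (ℕ → Set) → ℕ → Set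
HasCardℕ P k = Σ (List ℕ) λ xs → Unique xs × (∀ x → P x ⇔ (x ∈ xs)) × length xs ≡ k

HasCard-fromℕ : {X : ZSet} {P : ℕ → Set} {k : ℕ} →
  (∀ n → X n ⇔ (∃[ x ] (P x × n ≡ + x))) → HasCardℕ P k → HasCard X k
HasCard-fromℕ {X} X⇔P (xs , unique , P⇔xs , len) =
  map +_ xs , Unique.map⁺ +-injective unique , X⇔map+xs , trans (length-map +_ xs) len
  where
  X⇔map+xs : ∀ n → X n ⇔ (n ∈ map +_ xs)
  X⇔map+xs n = mk⇔
    (λ n∈X → let x , Px , n≡x = to (X⇔P n) n∈X
             in subst (_∈ map +_ xs) (sym n≡x) (∈-map⁺ +_ (to (P⇔xs x) Px)))
    (λ n∈xs → let x , x∈xs , n≡x = ∈-map⁻ +_ n∈xs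
              in from (X⇔P n) (x , from (P⇔xs x) x∈xs , n≡x))

Blocks : ℕ → ℕ → ℕ → ZSet
Blocks b m c = AP b m ⊕ Icc (+ 0) (+ c)

InBlocks : ℕ → ℕ → ℕ → ℕ → Set
InBlocks b m c x = ∃[ j ] ∃[ i ] (j ≤ m × i ≤ c × x ≡ j * b + i)

Blocks⇔InBlocks : ∀ b m c n → Blocks b m c n ⇔ (∃[ x ] (InBlocks b m c x × n ≡ + x))
Blocks⇔InBlocks b m c n = mk⇔
  (λ { (_ , _ , (j , j≤m , refl) , (+≤+ z≤n , +≤+ i≤c) , refl) → _ , (j , _ , j≤m , i≤c , refl) , refl })
  (λ { (_ , (j , i , j≤m , i≤c , refl) , refl) → _ , _ , (j , j≤m , refl) , (+≤+ z≤n , +≤+ i≤c) , refl })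

Blocks-zero : ∀ b → Blocks b 0 0 ≐ (_≡ + 0)
Blocks-zero b n = mk⇔
  (λ { (_ , _ , (0 , z≤n , refl) , (+≤+ z≤n , +≤+ z≤n) , refl) → refl })
  (λ { refl → + 0 , + 0 , (0 , z≤n , refl) , (+≤+ z≤n , +≤+ z≤n) , refl })

≤-+-split : ∀ {j} m {m′} → j ≤ m + m′ → ∃[ j₁ ] ∃[ j₂ ] (j₁ ≤ m × j₂ ≤ m′ × j ≡ j₁ + j₂)
≤-+-split {j} m j≤m+m′ =
  m ⊓ j , j ∸ m , m⊓n≤m m j , m≤n+o⇒m∸n≤o j m j≤m+m′ , sym (m⊓n+n∸m≡n m j)

block-+ : ∀ b j i j′ i′ → (j * b + i) + (j′ * b + i′) ≡ (j + j′) * b + (i + i′)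
block-+ = solve-∀

Blocks-⊕ : ∀ b m c m′ c′ → (Blocks b m c ⊕ Blocks b m′ c′) ≐ Blocks b (m + m′) (c + c′)
Blocks-⊕ b m c m′ c′ n = mk⇔
  (λ { (_ , _ , (_ , _ , (j , j≤m , refl) , (+≤+ z≤n , +≤+ i≤c) , refl)
              , (_ , _ , (j′ , j′≤m′ , refl) , (+≤+ z≤n , +≤+ i′≤c′) , refl) , refl)
       → _ , _ , (j + j′ , +-mono-≤ j≤m j′≤m′ , refl) , (+≤+ z≤n , +≤+ (+-mono-≤ i≤c i′≤c′))
       , cong +_ (block-+ b j _ j′ _) })
  (λ { (_ , _ , (j , j≤m+m′ , refl) , (+≤+ z≤n , +≤+ i≤c+c′) , refl) → split j≤m+m′ i≤c+c′ })
  where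
  split : ∀ {j i} → j ≤ m + m′ → i ≤ c + c′ → (Blocks b m c ⊕ Blocks b m′ c′) (+ (j * b + i))
  split j≤m+m′ i≤c+c′ with ≤-+-split m j≤m+m′ | ≤-+-split c i≤c+c′
  ... | j₁ , j₂ , j₁≤m , j₂≤m′ , refl | i₁ , i₂ , i₁≤c , i₂≤c′ , refl =
    _ , _ , (_ , _ , (j₁ , j₁≤m , refl) , (+≤+ z≤n , +≤+ i₁≤c) , refl)
          , (_ , _ , (j₂ , j₂≤m′ , refl) , (+≤+ z≤n , +≤+ i₂≤c′) , refl)
          , cong +_ (sym (block-+ b j₁ i₁ j₂ i₂))

hfold-Blocks : ∀ b m c h → hfold h (Blocks b m c) ≐ Blocks b (h * m) (h * c)
hfold-Blocks b m c zero = ≐-trans (hfold-zero _) (≐-sym (Blocks-zero b))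
hfold-Blocks b m c (suc h) =
  ≐-trans (hfold-suc h _) (≐-trans (⊕-congˡ (hfold-Blocks b m c h)) (Blocks-⊕ b m c (h * m) (h * c)))

InBlocks-shift : ∀ {b m c x} → InBlocks b m c x → InBlocks b (suc m) c (b + x)
InBlocks-shift {b} (j , i , j≤m , i≤c , refl) = suc j , i , s≤s j≤m , i≤c , sym (+-assoc b (j * b) i)

InBlocks-interval : ∀ b m c x → b ≤ suc c → InBlocks b m c x ⇔ x ≤ m * b + c
InBlocks-interval b m c x b≤1+c = mk⇔
  (λ { (j , i , j≤m , i≤c , refl) → +-mono-≤ (*-monoˡ-≤ b j≤m) i≤c })
  (fill m x)
  where
  fill : ∀ m x → x ≤ m * b + c → InBlocks b m c x
  fill zero x x≤c = 0 , x , z≤n , x≤c , refl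
  fill (suc m) x x≤ with x ≤? c
  ... | yes x≤c = 0 , x , z≤n , x≤c , refl
  ... | no x≰c = subst (InBlocks b (suc m) c) (m+[n∸m]≡n b≤x) (InBlocks-shift (fill m (x ∸ b) x∸b≤))
    where
    b≤x : b ≤ x
    b≤x = ≤-trans b≤1+c (≰⇒> x≰c)
    x∸b≤ : x ∸ b ≤ m * b + c
    x∸b≤ = m≤n+o⇒m∸n≤o x b (subst (x ≤_) (+-assoc b (m * b) c) x≤)

InBlocks-card-interval : ∀ b m c → b ≤ suc c → HasCardℕ (InBlocks b m c) (suc (m * b + c))
InBlocks-card-interval b m c b≤1+c =
  upTo (suc (m * b + c)) , Unique.upTo⁺ _ ,
  (λ x → ⇔.trans (InBlocks-interval b m c x b≤1+c)
                 (mk⇔ (λ x≤ → ∈-upTo⁺ (s≤s x≤)) (λ x∈ → ≤-pred (∈-upTo⁻ x∈)))) ,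
  length-upTo _

euclidean-unique : ∀ {b j j′ i i′} → i < b → i′ < b → j * b + i ≡ j′ * b + i′ → j ≡ j′ × i ≡ i′
euclidean-unique {b@(suc _)} {j} {j′} {i} {i′} i<b i′<b eq =
  *-cancelʳ-≡ j j′ b (+-cancelʳ-≡ i (j * b) (j′ * b) (trans eq (cong (_+_ (j′ * b)) (sym i≡i′)))) , i≡i′
  where
  open ≡-Reasoning
  i≡i′ : i ≡ i′
  i≡i′ = begin
    i               ≡⟨ m<n⇒m%n≡m i<b ⟨
    i % b           ≡⟨ [m+kn]%n≡m%n i j b ⟨
    (i + j * b) % b ≡⟨ cong (_% b) (trans (+-comm i (j * b)) (trans eq (+-comm (j′ * b) i′))) ⟩
    (i′ + j′ * b) % b ≡⟨ [m+kn]%n≡m%n i′ j′ b ⟩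
    i′ % b          ≡⟨ m<n⇒m%n≡m i′<b ⟩
    i′              ∎

length-cartesianProductWith : {A B C : Set} (f : A → B → C) (xs : List A) (ys : List B) →
  length (cartesianProductWith f xs ys) ≡ length xs * length ys
length-cartesianProductWith f [] ys = refl
length-cartesianProductWith f (x ∷ xs) ys = begin
  length (map (f x) ys ++ cartesianProductWith f xs ys)          ≡⟨ length-++ (map (f x) ys) ⟩
  length (map (f x) ys) + length (cartesianProductWith f xs ys) ≡⟨ cong₂ _+_ (length-map (f x) ys)
                                                                          (length-cartesianProductWith f xs ys) ⟩
  length ys + length xs * length ys                              ∎
  where open ≡-Reasoning

InBlocks-card-disjoint : ∀ b m c → c < b → HasCardℕ (InBlocks b m c) (suc m * suc c)
InBlocks-card-disjoint b m c c<b =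
  points , Unique.cartesianProductWith⁺ point point-injective (Unique.upTo⁺ (suc m)) (Unique.allFin⁺ (suc c)) ,
  InBlocks⇔points ,
  trans (length-cartesianProductWith point (upTo (suc m)) (allFin (suc c)))
        (cong₂ _*_ (length-upTo (suc m)) (length-tabulate (λ i → i)))
  where
  point : ℕ → Fin (suc c) → ℕ
  point j i = j * b + toℕ i

  points : List ℕ
  points = cartesianProductWith point (upTo (suc m)) (allFin (suc c))

  toℕ<b : (i : Fin (suc c)) → toℕ i < b
  toℕ<b i = ≤-<-trans (toℕ≤pred[n] i) c<b

  point-injective : ∀ {j j′ i i′} → point j i ≡ point j′ i′ → j ≡ j′ × i ≡ i′
  point-injective {i = i} {i′} eq =
    let j≡j′ , i≡i′ = euclidean-unique (toℕ<b i) (toℕ<b i′) eq in j≡j′ , toℕ-injective i≡i′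

  InBlocks⇔points : ∀ x → InBlocks b m c x ⇔ (x ∈ points)
  InBlocks⇔points x = mk⇔
    (λ { (j , i , j≤m , i≤c , refl) →
         subst (λ t → j * b + t ∈ points) (toℕ-fromℕ< (s≤s i≤c))
               (∈-cartesianProductWith⁺ point (∈-upTo⁺ (s≤s j≤m)) (∈-allFin _)) })
    (λ x∈points → let j , i , j∈ , _ , x≡ = ∈-cartesianProductWith⁻ point _ _ x∈points
                  in j , toℕ i , ≤-pred (∈-upTo⁻ j∈) , toℕ≤pred[n] i , x≡)

Blocks-card-interval : ∀ b m c → b ≤ suc c → HasCard (Blocks b m c) (suc (m * b + c))
Blocks-card-interval b m c b≤1+c = HasCard-fromℕ (Blocks⇔InBlocks b m c) (InBlocks-card-interval b m c b≤1+c)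

Blocks-card-disjoint : ∀ b m c → c < b → HasCard (Blocks b m c) (suc m * suc c)
Blocks-card-disjoint b m c c<b = HasCard-fromℕ (Blocks⇔InBlocks b m c) (InBlocks-card-disjoint b m c c<b)

interval-size : ∀ h ℓ a b → suc (h * ℓ * b + h * a) ≡ (a + b * ℓ) * h + 1
interval-size = solve-∀

disjoint-size : ∀ h ℓ a → suc (h * ℓ) * suc (h * a) ≡ a * ℓ * h ^ 2 + (suc a + suc ℓ ∸ 2) * h + 1
disjoint-size h ℓ a = begin
  suc (h * ℓ) * suc (h * a)               ≡⟨ expand h ℓ a ⟩
  a * ℓ * h ^ 2 + (a + ℓ) * h + 1         ≡⟨ cong (λ t → a * ℓ * h ^ 2 + t * h + 1) (cong (_∸ 1) (+-suc a ℓ)) ⟨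
  a * ℓ * h ^ 2 + (suc a + suc ℓ ∸ 2) * h + 1 ∎
  where
  open ≡-Reasoning
  expand : ∀ h ℓ a → suc (h * ℓ) * suc (h * a) ≡ a * ℓ * (h * (h * 1)) + (a + ℓ) * h + 1
  expand = solve-∀

mainTheorem2 : (k a b ℓ : ℕ) → 1 ≤ k → 1 ≤ a → 1 ≤ b → 1 ≤ ℓ →
  k ≡ a * ℓ → a ≤ b →
  HasCard (AP b (ℓ ∸ 1) ⊕ Icc (+ 0) (+ (a ∸ 1))) k
  × ((h : ℕ) → 1 ≤ h →
      (hfold h (AP b (ℓ ∸ 1) ⊕ Icc (+ 0) (+ (a ∸ 1)))
        ≐ (AP b (h * (ℓ ∸ 1)) ⊕ Icc (+ 0) (+ (h * (a ∸ 1)))))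
      × (b ≤ (a ∸ 1) * h + 1 →
          HasCard (hfold h (AP b (ℓ ∸ 1) ⊕ Icc (+ 0) (+ (a ∸ 1))))
            ((a + b * (ℓ ∸ 1) ∸ 1) * h + 1))
      × (h * (a ∸ 1) + 1 ≤ b →
          HasCard (hfold h (AP b (ℓ ∸ 1) ⊕ Icc (+ 0) (+ (a ∸ 1))))
            ((a ∸ 1) * (ℓ ∸ 1) * h ^ 2 + (a + ℓ ∸ 2) * h + 1)))
mainTheorem2 k (suc a) b (suc ℓ) _ (s≤s z≤n) _ (s≤s z≤n) refl a<b =
  card-A , λ h _ → hfold-Blocks b ℓ a h , card-hA-interval h , card-hA-disjoint h
  where
  card-A : HasCard (Blocks b ℓ a) (suc a * suc ℓ)
  card-A = subst (HasCard (Blocks b ℓ a)) (*-comm (suc ℓ) (suc a)) (Blocks-card-disjoint b ℓ a a<b)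

  card-hA-interval : ∀ h → b ≤ a * h + 1 → HasCard (hfold h (Blocks b ℓ a)) ((a + b * ℓ) * h + 1)
  card-hA-interval h b≤ah+1 = HasCard-resp-≐ (hfold-Blocks b ℓ a h)
    (subst (HasCard (Blocks b (h * ℓ) (h * a))) (interval-size h ℓ a b)
      (Blocks-card-interval b (h * ℓ) (h * a) (subst (b ≤_) (trans (+-comm (a * h) 1) (cong suc (*-comm a h))) b≤ah+1)))

  card-hA-disjoint : ∀ h → h * a + 1 ≤ b →
    HasCard (hfold h (Blocks b ℓ a)) (a * ℓ * h ^ 2 + (suc a + suc ℓ ∸ 2) * h + 1)
  card-hA-disjoint h ha+1≤b = HasCard-resp-≐ (hfold-Blocks b ℓ a h)
    (subst (HasCard (Blocks b (h * ℓ) (h * a)))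
      (disjoint-size h ℓ a)
      (Blocks-card-disjoint b (h * ℓ) (h * a) (subst (_≤ b) (+-comm (h * a) 1) ha+1≤b)))
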